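{- For every relational specification $F(\mathbf{X},\mathbf{Y})$, there exists a Skolem function vector for $\mathbf{X}$ in $F$ of size polynomial in $|F|$ if and only if there exists a specification $\widetilde{F}(\mathbf{X},\mathbf{Y})$ in $\mathsf{SynNNF}$ (w.r.t. $\mathbf{X}$) such that $\widetilde{F}\preceq_{syn}F$ and the size of $\widetilde{F}$ is polynomial in $|F|$.
   Context: Outputs $\mathbf{X}=(x_1,\ldots,x_n)$, inputs $\mathbf{Y}$. Sizes are sizes of AND/OR/NOT circuit (DAG) representations. A Skolem function vector for $\mathbf{X}$ in $F$ is $\Psi=(\psi_1(\mathbf{Y}),\ldots,\psi_n(\mathbf{Y}))$ with $\forall\mathbf{Y}\,(\exists\mathbf{X}\,F(\mathbf{X},\mathbf{Y})\Leftrightarrow F(\Psi(\mathbf{Y}),\mathbf{Y}))$. $\widetilde{F}\preceq_{syn}F$ means: (a) $\forall\mathbf{Y}\,(\exists\mathbf{X}\,F(\mathbf{X},\mathbf{Y})\Rightarrow\exists\mathbf{X}'\,\widetilde{F}(\mathbf{X}',\mathbf{Y}))$ and (b) $\forall\mathbf{Y}\,\forall\mathbf{X}'\,((\exists\mathbf{X}\,F(\mathbf{X},\mathbf{Y})\wedge\widetilde{F}(\mathbf{X}',\mathbf{Y}))\Rightarrow F(\mathbf{X}',\mathbf{Y}))$. NNF: only $\wedge,\vee,\neg$, negation only on variables. Positive form $\widehat{G}$ of an NNF formula $G$: replace each $\neg x_i$ by a fresh variable $\overline{x}_i$. $i$-th reduct $\widehat{G}^{\,i}$: $\widehat{G}$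 with $x_1,\ldots,x_{i-1},\overline{x}_1,\ldots,\overline{x}_{i-1}$ set to $1$. With $\alpha_i^{jk}=\widehat{G}^{\,i}[x_i\mapsto j,\overline{x}_i\mapsto k,\overline{x}_l\mapsto\neg x_l\ (l>i)]$, $\widehat{G}^{\,i}$ is $\wedge_i$-unrealizable if $\alpha_i^{11}\wedge\neg\alpha_i^{10}\wedge\neg\alpha_i^{01}$ is unsatisfiable. $G$ is in $\mathsf{SynNNF}$ w.r.t. $\mathbf{X}$ if $G$ is in NNF and $\widehat{G}^{\,i}$ is $\wedge_i$-unrealizable for all $1\le i\le n$. -}

module Defs where

open import Data.Nat using (ℕ; zero; suc; _+_; _*_; _^_; _≤_; _<ᵇ_; _≡ᵇ_)
open import Data.Fin using (Fin; zero; suc; toℕ)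
open import Data.Bool using (Bool; true; false; not; if_then_else_)
open import Data.Sum using (_⊎_; inj₁; inj₂; [_,_])
open import Data.Product using (Σ; _×_; ∃)
open import Data.Unit using (⊤)
open import Data.Empty using (⊥)
open import Relation.Nullary using (¬_)
open import Relation.Binary.PropositionalEquality using (_≡_)

-- Boolean circuits (DAGs) with AND / OR / NOT gates, as straight-line
-- programs.  The size of a circuit is its number of gates.

data Wire (V : Set) (g : ℕ) : Set where
  const : Bool → Wire V g
  inp   : V → Wire V g
  gate  : Fin g → Wire V g

data Gate (V : Set) (g : ℕ) : Set where
  AND OR : Wire V g → Wire V g → Gate V g
  NOT    : Wire V g → Gate V g

-- gates listed in topological order; the newest gate has index zero
data SLP (V : Set) : ℕ → Set where
  []  : SLP V 0
  _▷_ : ∀ {g} → SLP V g → Gate V g → SLP V (suc g)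

-- Generalised evaluation: 'pos' gives the value of a variable occurrence,
-- 'neg' gives the value of a NOT gate applied directly to a variable.  Taking 'neg'
-- independent of 'pos' gives the evaluation of the positive form.
wireVal : ∀ {V g} → (V → Bool) → (Fin g → Bool) → Wire V g → Bool
wireVal pos vals (const b) = b
wireVal pos vals (inp v)   = pos v
wireVal pos vals (gate i)  = vals i

notVal : ∀ {V g} → (V → Bool) → (V → Bool) → (Fin g → Bool) → Wire V g → Bool
notVal pos neg vals (inp v) = neg v
notVal pos neg vals w       = not (wireVal pos vals w)

gateVal : ∀ {V g} → (V → Bool) → (V → Bool) → (Fin g → Bool) → Gate V g → Bool
gateVal pos neg vals (AND a b) = wireVal pos vals a Data.Bool.∧ wireVal pos vals b
gateVal pos neg vals (OR a b)  = wireVal pos vals a Data.Bool.∨ wireVal pos vals b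
gateVal pos neg vals (NOT a)   = notVal pos neg vals a

evalSLP : ∀ {V g} → SLP V g → (V → Bool) → (V → Bool) → Fin g → Bool
evalSLP (c ▷ gt) pos neg zero    = gateVal pos neg (evalSLP c pos neg) gt
evalSLP (c ▷ gt) pos neg (suc i) = evalSLP c pos neg i

record Circuit (V : Set) (k : ℕ) : Set where
  field
    size : ℕ
    prog : SLP V size
    out  : Fin k → Wire V size
open Circuit public

evalGen : ∀ {V k} → Circuit V k → (V → Bool) → (V → Bool) → Fin k → Bool
evalGen C pos neg j = wireVal pos (evalSLP (prog C) pos neg) (out C j)

eval : ∀ {V k} → Circuit V k → (V → Bool) → Fin k → Bool
eval C ρ = evalGen C ρ (λ v → not (ρ v))

GateNNF : ∀ {V g} → Gate V g → Set
GateNNF (AND _ _)     = ⊤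
GateNNF (OR _ _)      = ⊤
GateNNF (NOT (inp _)) = ⊤
GateNNF (NOT _)       = ⊥

SLPNNF : ∀ {V g} → SLP V g → Set
SLPNNF []       = ⊤
SLPNNF (c ▷ gt) = SLPNNF c × GateNNF gt

IsNNF : ∀ {V k} → Circuit V k → Set
IsNNF C = SLPNNF (prog C)

-- Relational specifications F(X,Y): X = outputs x_1..x_n (Fin n),
-- Y = inputs (Fin m).

Spec : ℕ → ℕ → Set
Spec n m = Circuit (Fin n ⊎ Fin m) 1

_⟦_,_⟧ : ∀ {n m} → Spec n m → (Fin n → Bool) → (Fin m → Bool) → Bool
F ⟦ x , y ⟧ = eval F [ x , y ] zero

IsSkolem : ∀ {n m} → Spec n m → Circuit (Fin m) n → Set
IsSkolem F Ψ = ∀ y →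
  ((∃ λ x → F ⟦ x , y ⟧ ≡ true) → F ⟦ eval Ψ y , y ⟧ ≡ true)
  × (F ⟦ eval Ψ y , y ⟧ ≡ true → ∃ λ x → F ⟦ x , y ⟧ ≡ true)

_⪯syn_ : ∀ {n m} → Spec n m → Spec n m → Set
Ft ⪯syn F =
  (∀ y → (∃ λ x → F ⟦ x , y ⟧ ≡ true) → ∃ λ x' → Ft ⟦ x' , y ⟧ ≡ true)
  × (∀ y x' → (∃ λ x → F ⟦ x , y ⟧ ≡ true) → Ft ⟦ x' , y ⟧ ≡ true
            → F ⟦ x' , y ⟧ ≡ true)

-- α_i^{jk}: evaluation of the positive form Ĝ with
--   x_l, x̄_l ↦ 1 (l < i),  x_i ↦ j, x̄_i ↦ k,  x̄_l ↦ ¬x_l (l > i),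
-- negated input literals ¬y unchanged.  (Values of x_l, l ≤ i, in the
-- assignment x are ignored.)
alpha : ∀ {n m} → Spec n m → Fin n → Bool → Bool → (Fin n → Bool) → (Fin m → Bool) → Bool
alpha G i j k x y = evalGen G pos neg zero
  where
  pos : _ → Bool
  pos (inj₁ l) = if toℕ l <ᵇ toℕ i then true else (if toℕ l ≡ᵇ toℕ i then j else x l)
  pos (inj₂ l) = y l
  neg : _ → Bool
  neg (inj₁ l) = if toℕ l <ᵇ toℕ i then true else (if toℕ l ≡ᵇ toℕ i then k else not (x l))
  neg (inj₂ l) = not (y l)

AndUnrealizable : ∀ {n m} → Spec n m → Fin n → Set
AndUnrealizable G i = ∀ x y →
  ¬ (alpha G i true true x y ≡ true × alpha G i true false x y ≡ false
     × alpha G i false true x y ≡ false)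

SynNNF : ∀ {n m} → Spec n m → Set
SynNNF G = IsNNF G × (∀ i → AndUnrealizable G i)

record AnySpec : Set where
  constructor spec
  field
    nOut nIn : ℕ
    formula  : Spec nOut nIn
open AnySpec public

-- "every F in the class has a Skolem function vector of size polynomial in |F|"
-- (every polynomial is bounded by c * (s + 1) ^ d for some c, d)
PolySkolem : (AnySpec → Set) → Set
PolySkolem P = Σ ℕ λ c → Σ ℕ λ d → ∀ S → P S →
  Σ (Circuit (Fin (nIn S)) (nOut S)) λ Ψ →
    IsSkolem (formula S) Ψ × size Ψ ≤ c * (size (formula S) + 1) ^ d

PolySynNNF : (AnySpec → Set) → Set
PolySynNNF P = Σ ℕ λ c → Σ ℕ λ d → ∀ S → P S →
  Σ (Spec (nOut S) (nIn S)) λ Ft →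
    SynNNF Ft × (Ft ⪯syn formula S) × size Ft ≤ c * (size (formula S) + 1) ^ d

module Submission where

-- A SynNNF specification G yields Skolem functions by backward substitution: for
-- i = n, …, 1 put x_i := α_i^{10}(x_{i+1}, …, x_n), one copy of Ĝ for each output
-- variable occurring in G.  Setting x_l, x̄_l to 1 for l < i can only make the NNF
-- circuit truer, and ∧_i-unrealizability guarantees that fixing x_i in this way keeps
-- it true, so G(Ψ(Y), Y) holds whenever G(X, Y) does for some X.  Conversely, from a
-- Skolem vector Ψ take F̃ = ⋀_l (x_l ∧ ψ_l(Y)) ∨ (x̄_l ∧ ¬ψ_l(Y)) over the x_l occurring
-- in F, computing ψ_l and ¬ψ_l by a dual-rail NNF translation of Ψ.  Each x_i occurs
-- only in its own conjunct, so F̃ is ∧_i-unrealizable, and F̃ forces X = Ψ(Y) on every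
-- variable F depends on, so F̃ ⪯syn F.  Both constructions stay polynomial because at
-- most 1 + 2|F| output variables occur in F.

open import Defs
open import Function.Base using (_∘_)
open import Function.Bundles using (_⇔_; mk⇔)
open import Data.Nat using (ℕ; zero; suc; _+_; _*_; _^_; _≤_; _<_; _<ᵇ_; _≡ᵇ_; z≤n; s≤s; z<s; >-nonZero)
open import Data.Nat.Properties
open import Data.Fin using (Fin; zero; suc; toℕ; fromℕ<; _↑ʳ_; _↑ˡ_)
open import Data.Fin.Properties using (toℕ-injective; toℕ-fromℕ<; toℕ<n)
open import Data.Bool using (Bool; true; false; not; if_then_else_; _∧_; _∨_)
open import Data.Bool.Properties
  using ( if-cong-then; if-cong-else; if-cong₂; ∧-idem; ∧-conicalˡ; ∧-conicalʳ; ∨-zeroʳ; ∨-inverseʳ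
        ; not-involutive)
open import Data.Bool.ListAction using (any)
open import Data.Sum using (_⊎_; inj₁; inj₂; [_,_])
open import Data.Product using (Σ; _×_; _,_; proj₁; proj₂)
open import Data.Unit using (tt)
open import Data.Empty using (⊥; ⊥-elim)
open import Data.List using (List; []; _∷_; _++_; length)
open import Data.List.Properties using (length-++)
open import Data.List.Membership.Propositional using (_∈_)
open import Data.List.Membership.Propositional.Properties using (∈-++⁺ˡ; ∈-++⁺ʳ)
open import Data.List.Relation.Unary.Any using (here; there)
open import Relation.Binary.Definitions using (tri<; tri≈; tri>)
open import Relation.Binary.PropositionalEquality hiding ([_])
open import Relation.Nullary using (yes; no)
open import Data.Nat.Tactic.RingSolver using (solve-∀)
open import Algebra.Properties.CommutativeSemigroup +-commutativeSemigroup using (interchange)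

_⊑_ : Bool → Bool → Set
a ⊑ b = a ≡ true → b ≡ true

∧-mono-⊑ : ∀ {a b a′ b′} → a ⊑ a′ → b ⊑ b′ → (a ∧ b) ⊑ (a′ ∧ b′)
∧-mono-⊑ {true}  {true}  p q _ rewrite p refl | q refl = refl
∧-mono-⊑ {true}  {false} p q ()
∧-mono-⊑ {false}         p q ()

∨-mono-⊑ : ∀ {a b a′ b′} → a ⊑ a′ → b ⊑ b′ → (a ∨ b) ⊑ (a′ ∨ b′)
∨-mono-⊑ {true}           p q _ rewrite p refl = refl
∨-mono-⊑ {false} {a′ = a′} p q h rewrite q h = ∨-zeroʳ a′

not-∧ : ∀ a b → not (a ∧ b) ≡ not a ∨ not b
not-∧ true  b = refl
not-∧ false b = refl

not-∨ : ∀ a b → not (a ∨ b) ≡ not a ∧ not b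
not-∨ true  b = refl
not-∨ false b = refl

indicator : Bool → ℕ
indicator true  = 1
indicator false = 0

-- the positive form of the literal constraint  x ↔ b,  with x̄ for ¬x
iff⁺ : Bool → Bool → Bool → Bool
iff⁺ x x̄ b = (x ∧ b) ∨ (x̄ ∧ not b)

iff⁺-self : ∀ b → iff⁺ b (not b) b ≡ true
iff⁺-self true  = refl
iff⁺-self false = refl

iff⁺-sound : ∀ x b → iff⁺ x (not x) b ≡ true → x ≡ b
iff⁺-sound true  true  _ = refl
iff⁺-sound false false _ = refl

<ᵇ-true : ∀ {m n} → m < n → (m <ᵇ n) ≡ true
<ᵇ-true {zero}  {suc n} _       = refl
<ᵇ-true {suc m} {suc n} (s≤s p) = <ᵇ-true p

<ᵇ-false : ∀ {m n} → n ≤ m → (m <ᵇ n) ≡ false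
<ᵇ-false {m}     {zero}  _       = refl
<ᵇ-false {suc m} {suc n} (s≤s p) = <ᵇ-false p

≡ᵇ-true : ∀ {m n} → m ≡ n → (m ≡ᵇ n) ≡ true
≡ᵇ-true {zero}  refl = refl
≡ᵇ-true {suc m} refl = ≡ᵇ-true {m} refl

≡ᵇ-false : ∀ {m n} → m ≢ n → (m ≡ᵇ n) ≡ false
≡ᵇ-false {zero}  {zero}  m≢n = ⊥-elim (m≢n refl)
≡ᵇ-false {zero}  {suc n} _   = refl
≡ᵇ-false {suc m} {zero}  _   = refl
≡ᵇ-false {suc m} {suc n} m≢n = ≡ᵇ-false (m≢n ∘ cong suc)

module _ {n : ℕ} {A : Set} where

  cut : A → ℕ → (Fin n → A) → Fin n → A
  cut a k u l = if toℕ l <ᵇ k then a else u l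

  update : ℕ → A → (Fin n → A) → Fin n → A
  update r b u l = if toℕ l ≡ᵇ r then b else u l

  module _ {a : A} {k : ℕ} (u : Fin n → A) {l : Fin n} where

    cut-< : toℕ l < k → cut a k u l ≡ a
    cut-< p rewrite <ᵇ-true p = refl

    cut-≥ : k ≤ toℕ l → cut a k u l ≡ u l
    cut-≥ p rewrite <ᵇ-false p = refl

  module _ {r : ℕ} {b : A} (u : Fin n → A) {l : Fin n} where

    update-≡ : toℕ l ≡ r → update r b u l ≡ b
    update-≡ e rewrite ≡ᵇ-true e = refl

    update-≢ : toℕ l ≢ r → update r b u l ≡ u l
    update-≢ ne rewrite ≡ᵇ-false ne = refl

  update-irrelevant : ∀ {r b b′} u {l : Fin n} → toℕ l ≢ r → update r b u l ≡ update r b′ u l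
  update-irrelevant u l≢r = trans (update-≢ u l≢r) (sym (update-≢ u l≢r))

  cut-update-≡ : ∀ {a r b} u {l : Fin n} → toℕ l ≡ r → cut a r (update r b u) l ≡ b
  cut-update-≡ {r = r} {b} u e = trans (cut-≥ (update r b u) (≤-reflexive (sym e))) (update-≡ u e)

  cut-cong : ∀ {a k} {u u′ : Fin n → A} → (∀ l → k ≤ toℕ l → u l ≡ u′ l) →
             ∀ l → cut a k u l ≡ cut a k u′ l
  cut-cong {k = k} {u} {u′} e l with k ≤? toℕ l
  ... | yes k≤l = trans (cut-≥ u k≤l) (trans (e l k≤l) (sym (cut-≥ u′ k≤l)))
  ... | no  k≰l = trans (cut-< u (≰⇒> k≰l)) (sym (cut-< u′ (≰⇒> k≰l)))

  update-cong-above : ∀ {r b} {u u′ : Fin n → A} → (∀ l → r < toℕ l → u l ≡ u′ l) →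
                      ∀ l → r ≤ toℕ l → update r b u l ≡ update r b u′ l
  update-cong-above {u = u} {u′} e l r≤l with m≤n⇒m<n∨m≡n r≤l
  ... | inj₁ r<l = trans (update-≢ u (>⇒≢ r<l)) (trans (e l r<l) (sym (update-≢ u′ (>⇒≢ r<l))))
  ... | inj₂ r≡l = trans (update-≡ u (sym r≡l)) (sym (update-≡ u′ (sym r≡l)))

  update-self : ∀ {r} (u : Fin n → A) (i : Fin n) → toℕ i ≡ r → ∀ l → update r (u i) u l ≡ u l
  update-self {r} u i e l with toℕ l ≟ r
  ... | yes l≡r = trans (update-≡ u l≡r) (cong u (toℕ-injective (trans e (sym l≡r))))
  ... | no  l≢r = update-≢ u l≢r

module _ {n : ℕ} where

  cut-suc : ∀ {r} (u : Fin n → Bool) l → cut true (suc r) u l ≡ cut true r (update r true u) l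
  cut-suc {r} u l with <-cmp (toℕ l) r
  ... | tri< l<r _ _ = trans (cut-< u (m<n⇒m<1+n l<r)) (sym (cut-< (update r true u) l<r))
  ... | tri≈ _ l≡r _ = trans (cut-< u (s≤s (≤-reflexive l≡r))) (sym (cut-update-≡ u l≡r))
  ... | tri> _ _ r<l = trans (cut-≥ u r<l)
                         (sym (trans (cut-≥ (update r true u) (<⇒≤ r<l)) (update-≢ u (>⇒≢ r<l))))

  cut-mono : ∀ {r} (u : Fin n → Bool) l → cut true r u l ⊑ cut true (suc r) u l
  cut-mono {r} u l h with <-cmp (toℕ l) r
  ... | tri< l<r _ _ = cut-< u (m<n⇒m<1+n l<r)
  ... | tri≈ _ l≡r _ = cut-< u (s≤s (≤-reflexive l≡r))
  ... | tri> _ _ r<l = trans (cut-≥ u r<l) (trans (sym (cut-≥ u (<⇒≤ r<l))) h)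

val : ∀ {V g} → SLP V g → Wire V g → (V → Bool) → (V → Bool) → Bool
val c w pos neg = wireVal pos (evalSLP c pos neg) w

notVal-standard : ∀ {V g} (ρ : V → Bool) (f : Fin g → Bool) w →
                  notVal ρ (not ∘ ρ) f w ≡ not (wireVal ρ f w)
notVal-standard ρ f (const b) = refl
notVal-standard ρ f (inp v)   = refl
notVal-standard ρ f (gate i)  = refl

wireVars : ∀ {V g} → Wire V g → List V
wireVars (inp v) = v ∷ []
wireVars _       = []

gateVars : ∀ {V g} → Gate V g → List V
gateVars (AND a b) = wireVars a ++ wireVars b
gateVars (OR a b)  = wireVars a ++ wireVars b
gateVars (NOT a)   = wireVars a

slpVars : ∀ {V g} → SLP V g → List V
slpVars []       = []
slpVars (c ▷ gt) = gateVars gt ++ slpVars c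

vars : ∀ {V} → Circuit V 1 → List V
vars C = wireVars (out C zero) ++ slpVars (prog C)

module _ {V : Set} {pos neg pos′ neg′ : V → Bool} where

  AgreeOn : List V → Set
  AgreeOn vs = ∀ {v} → v ∈ vs → pos v ≡ pos′ v × neg v ≡ neg′ v

  module _ {g : ℕ} {f f′ : Fin g → Bool} (f≗f′ : ∀ i → f i ≡ f′ i) where

    wireVal-agree : ∀ w → AgreeOn (wireVars w) → wireVal pos f w ≡ wireVal pos′ f′ w
    wireVal-agree (const b) _ = refl
    wireVal-agree (inp v)   h = proj₁ (h (here refl))
    wireVal-agree (gate i)  _ = f≗f′ i

    notVal-agree : ∀ w → AgreeOn (wireVars w) → notVal pos neg f w ≡ notVal pos′ neg′ f′ w
    notVal-agree (const b) _ = refl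
    notVal-agree (inp v)   h = proj₂ (h (here refl))
    notVal-agree (gate i)  _ = cong not (f≗f′ i)

    gateVal-agree : ∀ gt → AgreeOn (gateVars gt) → gateVal pos neg f gt ≡ gateVal pos′ neg′ f′ gt
    gateVal-agree (AND a b) h = cong₂ _∧_ (wireVal-agree a (λ m → h (∈-++⁺ˡ m)))
                                          (wireVal-agree b (λ m → h (∈-++⁺ʳ (wireVars a) m)))
    gateVal-agree (OR a b)  h = cong₂ _∨_ (wireVal-agree a (λ m → h (∈-++⁺ˡ m)))
                                          (wireVal-agree b (λ m → h (∈-++⁺ʳ (wireVars a) m)))
    gateVal-agree (NOT a)   h = notVal-agree a h

  evalSLP-agree : ∀ {g} (c : SLP V g) → AgreeOn (slpVars c) → ∀ i → evalSLP c pos neg i ≡ evalSLP c pos′ neg′ i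
  evalSLP-agree (c ▷ gt) h zero    =
    gateVal-agree (evalSLP-agree c (λ m → h (∈-++⁺ʳ (gateVars gt) m))) gt (λ m → h (∈-++⁺ˡ m))
  evalSLP-agree (c ▷ gt) h (suc i) = evalSLP-agree c (λ m → h (∈-++⁺ʳ (gateVars gt) m)) i

  evalGen-agree : (C : Circuit V 1) → AgreeOn (vars C) → evalGen C pos neg zero ≡ evalGen C pos′ neg′ zero
  evalGen-agree C h = wireVal-agree (evalSLP-agree (prog C) (λ m → h (∈-++⁺ʳ (wireVars (out C zero)) m)))
                                    (out C zero) (λ m → h (∈-++⁺ˡ m))

evalGen-cong : ∀ {V} (C : Circuit V 1) {pos neg pos′ neg′ : V → Bool} →
               (∀ v → pos v ≡ pos′ v) → (∀ v → neg v ≡ neg′ v) →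
               evalGen C pos neg zero ≡ evalGen C pos′ neg′ zero
evalGen-cong C e e′ = evalGen-agree C (λ {v} _ → e v , e′ v)

module _ {V : Set} {pos neg pos′ neg′ : V → Bool}
         (pos⊑ : ∀ v → pos v ⊑ pos′ v) (neg⊑ : ∀ v → neg v ⊑ neg′ v) where

  wireVal-mono : ∀ {g} {f f′ : Fin g → Bool} → (∀ i → f i ⊑ f′ i) →
                 ∀ w → wireVal pos f w ⊑ wireVal pos′ f′ w
  wireVal-mono f⊑ (const b) h = h
  wireVal-mono f⊑ (inp v)   = pos⊑ v
  wireVal-mono f⊑ (gate i)  = f⊑ i

  evalSLP-mono : ∀ {g} (c : SLP V g) → SLPNNF c → ∀ i → evalSLP c pos neg i ⊑ evalSLP c pos′ neg′ i
  evalSLP-mono (c ▷ AND a b)     (nnf , _) zero = ∧-mono-⊑ (wireVal-mono (evalSLP-mono c nnf) a)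
                                                            (wireVal-mono (evalSLP-mono c nnf) b)
  evalSLP-mono (c ▷ OR a b)      (nnf , _) zero = ∨-mono-⊑ (wireVal-mono (evalSLP-mono c nnf) a)
                                                            (wireVal-mono (evalSLP-mono c nnf) b)
  evalSLP-mono (c ▷ NOT (inp v)) _         zero = neg⊑ v
  evalSLP-mono (c ▷ gt)          (nnf , _) (suc i) = evalSLP-mono c nnf i

  evalGen-mono : (C : Circuit V 1) → IsNNF C → evalGen C pos neg zero ⊑ evalGen C pos′ neg′ zero
  evalGen-mono C nnf = wireVal-mono (evalSLP-mono (prog C) nnf) (out C zero)

record _≼_ {V : Set} {g g′ : ℕ} (c : SLP V g) (c′ : SLP V g′) : Set where
  field
    lift     : Wire V g → Wire V g′
    val-lift : ∀ pos neg w → val c′ (lift w) pos neg ≡ val c w pos neg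
open _≼_ public

wk : ∀ {V g} → Wire V g → Wire V (suc g)
wk (const b) = const b
wk (inp v)   = inp v
wk (gate i)  = gate (suc i)

≼-▷ : ∀ {V g} {c : SLP V g} gt → c ≼ (c ▷ gt)
≼-▷ gt = record { lift = wk ; val-lift = λ { pos neg (const b) → refl ; pos neg (inp v) → refl
                                            ; pos neg (gate i) → refl } }

infixr 5 _⨾_
_⨾_ : ∀ {V g g′ g″} {c : SLP V g} {c′ : SLP V g′} {c″ : SLP V g″} → c ≼ c′ → c′ ≼ c″ → c ≼ c″
e ⨾ e′ = record { lift = lift e′ ∘ lift e
                ; val-lift = λ pos neg w → trans (val-lift e′ pos neg (lift e w)) (val-lift e pos neg w) }

module Substitution {V W : Set} {g₀ : ℕ} (base : SLP W g₀) (σ τ : V → Wire W g₀) where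

  liftBase : ∀ t → Wire W g₀ → Wire W (t + g₀)
  liftBase t (const b) = const b
  liftBase t (inp v)   = inp v
  liftBase t (gate i)  = gate (t ↑ʳ i)

  substWire : ∀ {t} → Wire V t → Wire W (t + g₀)
  substWire     (const b) = const b
  substWire {t} (inp v)   = liftBase t (σ v)
  substWire     (gate j)  = gate (j ↑ˡ g₀)

  substGate : ∀ {t} → Gate V t → Gate W (t + g₀)
  substGate     (AND a b)     = AND (substWire a) (substWire b)
  substGate     (OR a b)      = OR (substWire a) (substWire b)
  substGate {t} (NOT (inp v)) = NOT (liftBase t (τ v))
  substGate     (NOT a)       = NOT (substWire a)

  substSLP : ∀ {t} → SLP V t → SLP W (t + g₀)
  substSLP []       = base
  substSLP (c ▷ gt) = substSLP c ▷ substGate gt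

  module _ (pos neg : W → Bool) where

    σ-val : V → Bool
    σ-val v = val base (σ v) pos neg

    τ-val : V → Bool
    τ-val v = notVal pos neg (evalSLP base pos neg) (τ v)

    substSLP-base : ∀ {t} (c : SLP V t) i → evalSLP (substSLP c) pos neg (t ↑ʳ i) ≡ evalSLP base pos neg i
    substSLP-base []       i = refl
    substSLP-base (c ▷ gt) i = substSLP-base c i

    val-liftBase : ∀ {t} (c : SLP V t) w → val (substSLP c) (liftBase t w) pos neg ≡ val base w pos neg
    val-liftBase c (const b) = refl
    val-liftBase c (inp v)   = refl
    val-liftBase c (gate i)  = substSLP-base c i

    notVal-liftBase : ∀ {t} (c : SLP V t) w →
      notVal pos neg (evalSLP (substSLP c) pos neg) (liftBase t w) ≡ notVal pos neg (evalSLP base pos neg) w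
    notVal-liftBase c (const b) = refl
    notVal-liftBase c (inp v)   = refl
    notVal-liftBase c (gate i)  = cong not (substSLP-base c i)

    substWire-val : ∀ {t} (c : SLP V t) w →
                    val (substSLP c) (substWire w) pos neg ≡ wireVal σ-val (evalSLP c σ-val τ-val) w

    substSLP-val : ∀ {t} (c : SLP V t) j → evalSLP (substSLP c) pos neg (j ↑ˡ g₀) ≡ evalSLP c σ-val τ-val j
    substSLP-val (c ▷ AND a b)     zero    = cong₂ _∧_ (substWire-val c a) (substWire-val c b)
    substSLP-val (c ▷ OR a b)      zero    = cong₂ _∨_ (substWire-val c a) (substWire-val c b)
    substSLP-val (c ▷ NOT (inp v)) zero    = notVal-liftBase c (τ v)
    substSLP-val (c ▷ NOT (const b)) zero  = refl
    substSLP-val (c ▷ NOT (gate j)) zero   = cong not (substSLP-val c j)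
    substSLP-val (c ▷ gt)          (suc j) = substSLP-val c j

    substWire-val c (const b) = refl
    substWire-val c (inp v)   = val-liftBase c (σ v)
    substWire-val c (gate j)  = substSLP-val c j

module _ {n m : ℕ} where

  isOutputVar : ℕ → Fin n ⊎ Fin m → Bool
  isOutputVar k (inj₁ l) = toℕ l ≡ᵇ k
  isOutputVar k (inj₂ _) = false

  occurs : Spec n m → ℕ → Bool
  occurs F k = any (isOutputVar k) (vars F)

  occurs-∈ : (F : Spec n m) {l : Fin n} → inj₁ l ∈ vars F → occurs F (toℕ l) ≡ true
  occurs-∈ F {l} = any-∈ (vars F)
    where
    any-∈ : ∀ vs → inj₁ l ∈ vs → any (isOutputVar (toℕ l)) vs ≡ true
    any-∈ (_ ∷ _)  (here refl) rewrite ≡ᵇ-true {toℕ l} refl = refl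
    any-∈ (v ∷ vs) (there p)   rewrite any-∈ vs p = ∨-zeroʳ (isOutputVar (toℕ l) v)

count : (ℕ → Bool) → ℕ → ℕ → ℕ
count p r zero    = 0
count p r (suc d) = indicator (p r) + count p (suc r) d

count-∨ : ∀ p q r d → count (λ k → p k ∨ q k) r d ≤ count p r d + count q r d
count-∨ p q r zero    = z≤n
count-∨ p q r (suc d) = begin
  indicator (p r ∨ q r) + count (λ k → p k ∨ q k) (suc r) d
    ≤⟨ +-mono-≤ (indicator-∨ (p r)) (count-∨ p q (suc r) d) ⟩
  (indicator (p r) + indicator (q r)) + (count p (suc r) d + count q (suc r) d)
    ≡⟨ interchange (indicator (p r)) _ _ _ ⟩
  (indicator (p r) + count p (suc r) d) + (indicator (q r) + count q (suc r) d) ∎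
  where
  open ≤-Reasoning
  indicator-∨ : ∀ a {b} → indicator (a ∨ b) ≤ indicator a + indicator b
  indicator-∨ true  = s≤s z≤n
  indicator-∨ false = ≤-refl

count-≡ᵇ-below : ∀ a r d → a < r → count (a ≡ᵇ_) r d ≡ 0
count-≡ᵇ-below a r zero    _   = refl
count-≡ᵇ-below a r (suc d) a<r rewrite ≡ᵇ-false (<⇒≢ a<r) = count-≡ᵇ-below a (suc r) d (m<n⇒m<1+n a<r)

count-≡ᵇ : ∀ a r d → count (a ≡ᵇ_) r d ≤ 1
count-≡ᵇ a r zero = z≤n
count-≡ᵇ a r (suc d) with <-cmp a r
... | tri< a<r _ _ rewrite count-≡ᵇ-below a r (suc d) a<r = z≤n
... | tri≈ _ a≡r _ rewrite ≡ᵇ-true a≡r | count-≡ᵇ-below a (suc r) d (s≤s (≤-reflexive a≡r)) = ≤-refl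
... | tri> _ a≢r _   rewrite ≡ᵇ-false a≢r = count-≡ᵇ a (suc r) d

count-false : ∀ r d → count (λ _ → false) r d ≡ 0
count-false r zero    = refl
count-false r (suc d) = count-false (suc r) d

count-any : ∀ {n m} (vs : List (Fin n ⊎ Fin m)) r d → count (λ k → any (isOutputVar k) vs) r d ≤ length vs
count-any []       r d = ≤-reflexive (count-false r d)
count-any (v ∷ vs) r d = ≤-trans (count-∨ (λ k → isOutputVar k v) (λ k → any (isOutputVar k) vs) r d)
                                 (+-mono-≤ (count-isOutputVar v) (count-any vs r d))
  where
  count-isOutputVar : ∀ v → count (λ k → isOutputVar k v) r d ≤ 1
  count-isOutputVar (inj₁ l) = count-≡ᵇ (toℕ l) r d
  count-isOutputVar (inj₂ _) = ≤-trans (≤-reflexive (count-false r d)) z≤n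

length-wireVars : ∀ {V g} (w : Wire V g) → length (wireVars w) ≤ 1
length-wireVars (const b) = z≤n
length-wireVars (inp v)   = ≤-refl
length-wireVars (gate i)  = z≤n

length-wireVars-++ : ∀ {V g} (a b : Wire V g) → length (wireVars a ++ wireVars b) ≤ 2
length-wireVars-++ a b = ≤-trans (≤-reflexive (length-++ (wireVars a))) (+-mono-≤ (length-wireVars a) (length-wireVars b))

length-gateVars : ∀ {V g} (gt : Gate V g) → length (gateVars gt) ≤ 2
length-gateVars (AND a b) = length-wireVars-++ a b
length-gateVars (OR a b)  = length-wireVars-++ a b
length-gateVars (NOT a)   = m≤n⇒m≤1+n (length-wireVars a)

length-slpVars : ∀ {V g} (c : SLP V g) → length (slpVars c) ≤ 2 * g
length-slpVars []                   = z≤n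
length-slpVars {g = suc g} (c ▷ gt) = begin
  length (gateVars gt ++ slpVars c)           ≡⟨ length-++ (gateVars gt) ⟩
  length (gateVars gt) + length (slpVars c)   ≤⟨ +-mono-≤ (length-gateVars gt) (length-slpVars c) ⟩
  2 + 2 * g                                   ≡⟨ *-suc 2 g ⟨
  2 * suc g                                   ∎
  where open ≤-Reasoning

length-vars : ∀ {V} (C : Circuit V 1) → length (vars C) ≤ 1 + 2 * size C
length-vars C = ≤-trans (≤-reflexive (length-++ (wireVars (out C zero))))
                        (+-mono-≤ (length-wireVars (out C zero)) (length-slpVars (prog C)))

count-occurs : ∀ {n m} (F : Spec n m) r d → count (occurs F) r d ≤ 1 + 2 * size F
count-occurs F r d = ≤-trans (count-any (vars F) r d) (length-vars F)

-- Folding over the indices r, r + 1, …, n − 1 of Fin n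

module _ {n : ℕ} where

  index : ∀ {r d} → r + suc d ≡ n → Fin n
  index {r} eq = fromℕ< (<-≤-trans (m<m+n r z<s) (≤-reflexive eq))

  toℕ-index : ∀ {r d} (eq : r + suc d ≡ n) → toℕ (index eq) ≡ r
  toℕ-index eq = toℕ-fromℕ< _

  next : ∀ {r d} → r + suc d ≡ n → suc r + d ≡ n
  next {r} {d} eq = trans (sym (+-suc r d)) eq

  foldrFrom : ∀ {A : Set} → (Fin n → A → A) → A → ∀ r d → r + d ≡ n → A
  foldrFrom f a r zero    _  = a
  foldrFrom f a r (suc d) eq = f (index eq) (foldrFrom f a (suc r) d (next eq))

  foldrFrom-sim : ∀ {A B : Set} (R : A → B → Set) {f : Fin n → A → A} {g : Fin n → B → B} {a b} →
                  R a b → (∀ i {a b} → R a b → R (f i a) (g i b)) →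
                  ∀ r d eq → R (foldrFrom f a r d eq) (foldrFrom g b r d eq)
  foldrFrom-sim R base step r zero    eq = base
  foldrFrom-sim R base step r (suc d) eq = step (index eq) (foldrFrom-sim R base step (suc r) d (next eq))

  foldrFrom-measure : ∀ {A : Set} (μ : A → ℕ) (c : ℕ) (p : ℕ → Bool) {f : Fin n → A → A} {a} →
                      (∀ i a → μ (f i a) ≡ c * indicator (p (toℕ i)) + μ a) →
                      ∀ r d eq → μ (foldrFrom f a r d eq) ≡ c * count p r d + μ a
  foldrFrom-measure μ c p {f} {a} step r zero    eq = cong (_+ μ a) (sym (*-zeroʳ c))
  foldrFrom-measure μ c p {f} {a} step r (suc d) eq = begin
    μ (f i rest)                                            ≡⟨ step i rest ⟩
    c * indicator (p (toℕ i)) + μ rest                      ≡⟨ cong₂ (λ k s → c * indicator (p k) + s) (toℕ-index eq)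
                                                                     (foldrFrom-measure μ c p step (suc r) d (next eq)) ⟩
    c * indicator (p r) + (c * count p (suc r) d + μ a)     ≡⟨ +-assoc (c * indicator (p r)) _ _ ⟨
    c * indicator (p r) + c * count p (suc r) d + μ a       ≡⟨ cong (_+ μ a) (*-distribˡ-+ c (indicator (p r)) _) ⟨
    c * count p r (suc d) + μ a                             ∎
    where
    open ≡-Reasoning
    i    = index eq
    rest = foldrFrom f a (suc r) d (next eq)

  ⋀From : (Fin n → Bool) → ∀ r d → r + d ≡ n → Bool
  ⋀From T = foldrFrom (λ i b → T i ∧ b) true

  ⋀From-cong : ∀ {T T′} → (∀ i → T i ≡ T′ i) → ∀ r d eq → ⋀From T r d eq ≡ ⋀From T′ r d eq
  ⋀From-cong T≗T′ = foldrFrom-sim _≡_ refl (λ i b≡b′ → cong₂ _∧_ (T≗T′ i) b≡b′)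

  ⋀From-true : ∀ {T} → (∀ i → T i ≡ true) → ∀ r d eq → ⋀From T r d eq ≡ true
  ⋀From-true T-true r zero    eq = refl
  ⋀From-true T-true r (suc d) eq = cong₂ _∧_ (T-true (index eq)) (⋀From-true T-true (suc r) d (next eq))

  ⋀From-elim : ∀ {T} r d eq → ⋀From T r d eq ≡ true → ∀ l → r ≤ toℕ l → T l ≡ true
  ⋀From-elim r zero eq _ l r≤l =
    ⊥-elim (<⇒≱ (toℕ<n l) (≤-trans (≤-reflexive (trans (sym eq) (+-identityʳ r))) r≤l))
  ⋀From-elim {T} r (suc d) eq h l r≤l with m≤n⇒m<n∨m≡n r≤l
  ... | inj₁ r<l = ⋀From-elim (suc r) d (next eq) (∧-conicalʳ _ _ h) l r<l
  ... | inj₂ r≡l = subst (λ i → T i ≡ true) (toℕ-injective (trans (toℕ-index eq) r≡l)) (∧-conicalˡ _ _ h)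

module Positive {n m : ℕ} (G : Spec n m) where

  evalPositive : (Fin n → Bool) → (Fin n → Bool) → (Fin m → Bool) → Bool
  evalPositive p q y = evalGen G [ p , y ] [ q , not ∘ y ] zero

  evalPositive-cong : ∀ {p q p′ q′} y → (∀ l → p l ≡ p′ l) → (∀ l → q l ≡ q′ l) →
                      evalPositive p q y ≡ evalPositive p′ q′ y
  evalPositive-cong y p≗p′ q≗q′ = evalGen-cong G (λ { (inj₁ l) → p≗p′ l ; (inj₂ _) → refl })
                                                  (λ { (inj₁ l) → q≗q′ l ; (inj₂ _) → refl })

  alpha-positive : ∀ i j k x y → alpha G i j k x y ≡
    evalPositive (cut true (toℕ i) (update (toℕ i) j x)) (cut true (toℕ i) (update (toℕ i) k (not ∘ x))) y
  alpha-positive i j k x y = evalGen-cong G (λ { (inj₁ l) → refl ; (inj₂ _) → refl })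
                                            (λ { (inj₁ l) → refl ; (inj₂ _) → refl })

  alpha-cong-above : ∀ i {j k x x′} y → (∀ l → toℕ i < toℕ l → x l ≡ x′ l) →
                     alpha G i j k x y ≡ alpha G i j k x′ y
  alpha-cong-above i {j} {k} {x} {x′} y x≗x′ = begin
    alpha G i j k x y                    ≡⟨ alpha-positive i j k x y ⟩
    evalPositive (cut true r (update r j x)) (cut true r (update r k (not ∘ x))) y
      ≡⟨ evalPositive-cong y (cut-cong (update-cong-above x≗x′))
                             (cut-cong (update-cong-above (λ l r<l → cong not (x≗x′ l r<l)))) ⟩
    evalPositive (cut true r (update r j x′)) (cut true r (update r k (not ∘ x′))) y
                                         ≡⟨ alpha-positive i j k x′ y ⟨
    alpha G i j k x′ y                   ∎
    where
    open ≡-Reasoning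
    r = toℕ i

  alpha-absent : ∀ i {x} y → occurs G (toℕ i) ≡ false → alpha G i true true x y ≡ alpha G i false true x y
  alpha-absent i {x} y absent = begin
    alpha G i true true x y                          ≡⟨ alpha-positive i true true x y ⟩
    evalPositive (cut true r (update r true x)) x̄ y  ≡⟨ evalGen-agree G agree ⟩
    evalPositive (cut true r (update r false x)) x̄ y ≡⟨ alpha-positive i false true x y ⟨
    alpha G i false true x y                         ∎
    where
    open ≡-Reasoning
    r  = toℕ i
    x̄  = cut true r (update r true (not ∘ x))
    agree : AgreeOn (vars G)
    agree {inj₂ _} _ = refl , refl
    agree {inj₁ l} l∈G = if-cong-else (toℕ l <ᵇ r) (update-irrelevant x l≢i) , refl
      where
      l≢i : toℕ l ≢ r
      l≢i l≡i with () ← trans (sym (subst (λ k → occurs G k ≡ true) l≡i (occurs-∈ G l∈G))) absent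

  relax : ℕ → (Fin n → Bool) → (Fin m → Bool) → Bool
  relax k x y = evalPositive (cut true k x) (cut true k (not ∘ x)) y

  relax-zero : ∀ x y → relax 0 x y ≡ G ⟦ x , y ⟧
  relax-zero x y = evalGen-cong G (λ { (inj₁ l) → refl ; (inj₂ _) → refl })
                                  (λ { (inj₁ l) → refl ; (inj₂ _) → refl })

  relax-cong : ∀ k {x x′} y → (∀ l → k ≤ toℕ l → x l ≡ x′ l) → relax k x y ≡ relax k x′ y
  relax-cong k y x≗x′ = evalPositive-cong y (cut-cong x≗x′) (cut-cong (λ l k≤l → cong not (x≗x′ l k≤l)))

  relax-suc : ∀ i x y → relax (suc (toℕ i)) x y ≡ alpha G i true true x y
  relax-suc i x y = trans (evalPositive-cong y (cut-suc x) (cut-suc (not ∘ x))) (sym (alpha-positive i true true x y))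

  relax-toℕ : ∀ i x y → relax (toℕ i) x y ≡ alpha G i (x i) (not (x i)) x y
  relax-toℕ i x y = trans (evalPositive-cong y (cut-cong {k = toℕ i} (λ l _ → sym (update-self x i refl l)))
                                               (cut-cong {k = toℕ i} (λ l _ → sym (update-self (not ∘ x) i refl l))))
                          (sym (alpha-positive i (x i) (not (x i)) x y))

  relax-mono : IsNNF G → ∀ k x y → relax 0 x y ⊑ relax k x y
  relax-mono nnf zero    x y h = h
  relax-mono nnf (suc k) x y h =
    evalGen-mono (λ { (inj₁ l) → cut-mono x l ; (inj₂ _) → λ h → h })
                 (λ { (inj₁ l) → cut-mono (not ∘ x) l ; (inj₂ _) → λ h → h }) G nnf (relax-mono nnf k x y h)

  -- ∧_i-unrealizability is what allows x_i to be fixed to α_i^{10}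
  alpha-choice : ∀ i x y → AndUnrealizable G i → alpha G i true true x y ≡ true →
    let b = if occurs G (toℕ i) then alpha G i true false x y else false in alpha G i b (not b) x y ≡ true
  alpha-choice i x y unr α¹¹ with occurs G (toℕ i) in absent
  ... | false = trans (sym (alpha-absent i y absent)) α¹¹
  ... | true with alpha G i true false x y in α¹⁰
  ...   | true  = α¹⁰
  ...   | false with alpha G i false true x y in α⁰¹
  ...     | true  = refl
  ...     | false = ⊥-elim (unr x y (α¹¹ , α¹⁰ , α⁰¹))

  ⟦⟧-cong : ∀ {x x′} y → (∀ l → x l ≡ x′ l) → G ⟦ x , y ⟧ ≡ G ⟦ x′ , y ⟧
  ⟦⟧-cong y x≗x′ = evalGen-cong G (λ { (inj₁ l) → x≗x′ l ; (inj₂ _) → refl })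
                                  (λ { (inj₁ l) → cong not (x≗x′ l) ; (inj₂ _) → refl })

-- From SynNNF to Skolem functions

module SkolemFromSynNNF {n m : ℕ} (G : Spec n m) where
  open Positive G

  skolemStep : Bool → (Fin m → Bool) → Fin n → (Fin n → Bool) → Fin n → Bool
  skolemStep b y i x = update (toℕ i) (if b then alpha G i true false x y else false) x

  skolemVec : (Fin m → Bool) → ∀ r d → r + d ≡ n → Fin n → Bool
  skolemVec y = foldrFrom (λ i → skolemStep (occurs G (toℕ i)) y i) (λ _ → false)

  module _ (syn : SynNNF G) (y : Fin m → Bool) where

    descend-step : ∀ i {r} → toℕ i ≡ r → ∀ x → relax (suc r) x y ≡ true →
                   relax r (skolemStep (occurs G (toℕ i)) y i x) y ≡ true
    descend-step i refl x h = begin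
      relax (toℕ i) x′ y                  ≡⟨ relax-toℕ i x′ y ⟩
      alpha G i (x′ i) (not (x′ i)) x′ y  ≡⟨ cong (λ c → alpha G i c (not c) x′ y) (update-≡ x {i} refl) ⟩
      alpha G i b (not b) x′ y            ≡⟨ alpha-cong-above i y (λ l i<l → update-≢ x (>⇒≢ i<l)) ⟩
      alpha G i b (not b) x y             ≡⟨ alpha-choice i x y (proj₂ syn i) (trans (sym (relax-suc i x y)) h) ⟩
      true                                ∎
      where
      open ≡-Reasoning
      b  = if occurs G (toℕ i) then alpha G i true false x y else false
      x′ = skolemStep (occurs G (toℕ i)) y i x

    descend : (∀ x → relax n x y ≡ true) → ∀ r d eq → relax r (skolemVec y r d eq) y ≡ true
    descend top r zero    eq = subst (λ k → relax k _ y ≡ true) (trans (sym eq) (+-identityʳ r)) (top _)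
    descend top r (suc d) eq =
      descend-step (index eq) (toℕ-index eq) _ (descend top (suc r) d (next eq))

    -- relax n no longer depends on x, and relax 0 ⊑ relax n by monotonicity of the NNF circuit
    skolemVec-correct : ∀ {x₀} → G ⟦ x₀ , y ⟧ ≡ true → G ⟦ skolemVec y 0 n refl , y ⟧ ≡ true
    skolemVec-correct {x₀} h = trans (sym (relax-zero _ y)) (descend top 0 n refl)
      where
      top : ∀ x → relax n x y ≡ true
      top x = trans (relax-cong n y (λ l n≤l → ⊥-elim (<⇒≱ (toℕ<n l) n≤l)))
                    (relax-mono (proj₁ syn) n x₀ y (trans (relax-zero x₀ y) h))

  emptyCircuit : Circuit (Fin m) n
  emptyCircuit = record { size = 0 ; prog = [] ; out = λ _ → const false }

  module StepCircuit (i : Fin n) (C : Circuit (Fin m) n) where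
    r = toℕ i

    σ τ : Fin n ⊎ Fin m → Wire (Fin m) (size C)
    σ = [ cut (const true)  r (update r (const true) (out C)) , inp ]
    τ = [ cut (const false) r (update r (const true) (out C)) , inp ]

    open Substitution (prog C) σ τ public

    circuit : Circuit (Fin m) n
    circuit = record { size = size G + size C
                     ; prog = substSLP (prog G)
                     ; out  = update r (substWire (out G zero)) (liftBase (size G) ∘ out C) }

    module _ (y : Fin m → Bool) {x : Fin n → Bool} (C≗x : ∀ l → eval C y l ≡ x l) where

      σ-val-alpha : ∀ l → σ-val y (not ∘ y) (inj₁ l) ≡ cut true r (update r true x) l
      σ-val-alpha l with toℕ l <ᵇ r | toℕ l ≡ᵇ r
      ... | true  | _     = refl
      ... | false | true  = refl
      ... | false | false = C≗x l

      τ-val-alpha : ∀ l → τ-val y (not ∘ y) (inj₁ l) ≡ cut true r (update r false (not ∘ x)) l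
      τ-val-alpha l with toℕ l <ᵇ r | toℕ l ≡ᵇ r
      ... | true  | _     = refl
      ... | false | true  = refl
      ... | false | false = trans (notVal-standard y _ (out C l)) (cong not (C≗x l))

      circuit-eval : ∀ l → eval circuit y l ≡ update r (alpha G i true false x y) x l
      circuit-eval l with toℕ l ≡ᵇ r
      ... | true  = trans (substWire-val y (not ∘ y) (prog G) (out G zero))
                          (trans (evalGen-cong G (λ { (inj₁ l) → σ-val-alpha l ; (inj₂ _) → refl })
                                                 (λ { (inj₁ l) → τ-val-alpha l ; (inj₂ _) → refl }))
                                 (sym (alpha-positive i true false x y)))
      ... | false = trans (val-liftBase y (not ∘ y) (prog G) (out C l)) (C≗x l)

  skolemStepCircuit : Bool → Fin n → Circuit (Fin m) n → Circuit (Fin m) n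
  skolemStepCircuit true  i C = StepCircuit.circuit i C
  skolemStepCircuit false i C = record C { out = update (toℕ i) (const false) (out C) }

  skolemStepCircuit-eval : ∀ b i {C} y {x} → (∀ l → eval C y l ≡ x l) →
                           ∀ l → eval (skolemStepCircuit b i C) y l ≡ skolemStep b y i x l
  skolemStepCircuit-eval true  i {C} y C≗x = StepCircuit.circuit-eval i C y C≗x
  skolemStepCircuit-eval false i     y C≗x l with toℕ l ≡ᵇ toℕ i
  ... | true  = refl
  ... | false = C≗x l

  skolemStepCircuit-size : ∀ b i C → size (skolemStepCircuit b i C) ≡ size G * indicator b + size C
  skolemStepCircuit-size true  i C = cong (_+ size C) (sym (*-identityʳ (size G)))
  skolemStepCircuit-size false i C = cong (_+ size C) (sym (*-zeroʳ (size G)))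

  skolemCircuit : Circuit (Fin m) n
  skolemCircuit = foldrFrom (λ i → skolemStepCircuit (occurs G (toℕ i)) i) emptyCircuit 0 n refl

  skolemCircuit-isSkolem : SynNNF G → IsSkolem G skolemCircuit
  skolemCircuit-isSkolem syn y = (λ (_ , h) → trans (⟦⟧-cong y eval≗vec) (skolemVec-correct syn y h))
                               , (λ h → eval skolemCircuit y , h)
    where
    eval≗vec : ∀ l → eval skolemCircuit y l ≡ skolemVec y 0 n refl l
    eval≗vec = foldrFrom-sim (λ C x → ∀ l → eval C y l ≡ x l) {g = λ i → skolemStep (occurs G (toℕ i)) y i}
                             {b = λ _ → false} (λ _ → refl)
                             (λ i → skolemStepCircuit-eval (occurs G (toℕ i)) i y) 0 n refl

  skolemCircuit-size : size skolemCircuit ≤ size G * (1 + 2 * size G)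
  skolemCircuit-size = begin
    size skolemCircuit                    ≡⟨ foldrFrom-measure size (size G) (occurs G)
                                               (λ i → skolemStepCircuit-size (occurs G (toℕ i)) i) 0 n refl ⟩
    size G * count (occurs G) 0 n + 0     ≡⟨ +-identityʳ _ ⟩
    size G * count (occurs G) 0 n         ≤⟨ *-monoʳ-≤ (size G) (count-occurs G 0 n) ⟩
    size G * (1 + 2 * size G)             ∎
    where open ≤-Reasoning

-- Dual-rail NNF translation: each gate of a circuit over W is computed together
-- with its negation by an NNF circuit over V, reading the input w as ι w

module DualRail {W V : Set} (ι : W → V) where

  Consistent : (V → Bool) → (V → Bool) → Set
  Consistent pos neg = ∀ w → neg (ι w) ≡ not (pos (ι w))

  srcVal : ∀ {t} → SLP W t → (V → Bool) → Fin t → Bool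
  srcVal src pos = evalSLP src (pos ∘ ι) (not ∘ pos ∘ ι)

  srcWireVal : ∀ {t} → SLP W t → (V → Bool) → Wire W t → Bool
  srcWireVal src pos = wireVal (pos ∘ ι) (srcVal src pos)

  record Rails {t g} (src : SLP W t) (c : SLP V g) : Set where
    field
      posRail negRail : Fin t → Wire V g
      posRail-val : ∀ {pos neg} → Consistent pos neg → ∀ j → val c (posRail j) pos neg ≡ srcVal src pos j
      negRail-val : ∀ {pos neg} → Consistent pos neg → ∀ j → val c (negRail j) pos neg ≡ not (srcVal src pos j)
  open Rails public

  Rails-≼ : ∀ {t g g′} {src : SLP W t} {c : SLP V g} {c′ : SLP V g′} → c ≼ c′ → Rails src c → Rails src c′
  Rails-≼ e R = record
    { posRail     = lift e ∘ posRail R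
    ; negRail     = lift e ∘ negRail R
    ; posRail-val = λ cons j → trans (val-lift e _ _ (posRail R j)) (posRail-val R cons j)
    ; negRail-val = λ cons j → trans (val-lift e _ _ (negRail R j)) (negRail-val R cons j) }

  -- ¬ι w needs a NOT gate of its own; the dummy gate for other wires keeps the
  -- translation at four gates per source gate
  negGate : ∀ {t g} → Wire W t → Gate V g
  negGate (inp w) = NOT (inp (ι w))
  negGate _       = AND (const true) (const true)

  negGate-nnf : ∀ {t g} (q : Wire W t) → GateNNF (negGate {g = g} q)
  negGate-nnf (const b) = tt
  negGate-nnf (inp w)   = tt
  negGate-nnf (gate j)  = tt

  module _ {t g : ℕ} {src : SLP W t} {c : SLP V g} (R : Rails src c) where

    posWire : Wire W t → Wire V g
    posWire (const b) = const b
    posWire (inp w)   = inp (ι w)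
    posWire (gate j)  = posRail R j

    negWire : Wire W t → Wire V (suc g)
    negWire (const b) = const (not b)
    negWire (inp w)   = gate zero
    negWire (gate j)  = wk (negRail R j)

    module _ {pos neg : V → Bool} (cons : Consistent pos neg) where

      posWire-val : ∀ q → val c (posWire q) pos neg ≡ srcWireVal src pos q
      posWire-val (const b) = refl
      posWire-val (inp w)   = refl
      posWire-val (gate j)  = posRail-val R cons j

      negWire-val : ∀ q → val (c ▷ negGate q) (negWire q) pos neg ≡ not (srcWireVal src pos q)
      negWire-val (const b) = refl
      negWire-val (inp w)   = cons w
      negWire-val (gate j)  = trans (val-lift (≼-▷ (negGate (gate j))) pos neg (negRail R j)) (negRail-val R cons j)

  fstArg sndArg : ∀ {t} → Gate W t → Wire W t
  fstArg (AND a _) = a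
  fstArg (OR a _)  = a
  fstArg (NOT a)   = a
  sndArg (AND _ b) = b
  sndArg (OR _ b)  = b
  sndArg (NOT a)   = a

  gateOp : ∀ {t} → Gate W t → Bool → Bool → Bool
  gateOp (AND _ _) = _∧_
  gateOp (OR _ _)  = _∨_
  gateOp (NOT _)   = λ a _ → not a

  srcVal-▷ : ∀ {t} (src : SLP W t) gt pos →
    srcVal (src ▷ gt) pos zero ≡ gateOp gt (srcWireVal src pos (fstArg gt)) (srcWireVal src pos (sndArg gt))
  srcVal-▷ src (AND a b) pos = refl
  srcVal-▷ src (OR a b)  pos = refl
  srcVal-▷ src (NOT a)   pos = notVal-standard (pos ∘ ι) _ a

  posGateOf negGateOf : ∀ {t g} → Gate W t → (pa pb na nb : Wire V g) → Gate V g
  posGateOf (AND _ _) pa pb na nb = AND pa pb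
  posGateOf (OR _ _)  pa pb na nb = OR pa pb
  posGateOf (NOT _)   pa pb na nb = AND na na
  negGateOf (AND _ _) pa pb na nb = OR na nb
  negGateOf (OR _ _)  pa pb na nb = AND na nb
  negGateOf (NOT _)   pa pb na nb = AND pa pa

  module _ {t g : ℕ} {pa pb na nb : Wire V g} where

    posGateOf-nnf : (gt : Gate W t) → GateNNF (posGateOf gt pa pb na nb)
    posGateOf-nnf (AND _ _) = tt
    posGateOf-nnf (OR _ _)  = tt
    posGateOf-nnf (NOT _)   = tt

    negGateOf-nnf : (gt : Gate W t) → GateNNF (negGateOf gt pa pb na nb)
    negGateOf-nnf (AND _ _) = tt
    negGateOf-nnf (OR _ _)  = tt
    negGateOf-nnf (NOT _)   = tt

    module _ {pos neg : V → Bool} {f : Fin g → Bool} {A B : Bool}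
             (pa≡ : wireVal pos f pa ≡ A) (pb≡ : wireVal pos f pb ≡ B)
             (na≡ : wireVal pos f na ≡ not A) (nb≡ : wireVal pos f nb ≡ not B) where

      posGateOf-val : (gt : Gate W t) → gateVal pos neg f (posGateOf gt pa pb na nb) ≡ gateOp gt A B
      posGateOf-val (AND _ _) = cong₂ _∧_ pa≡ pb≡
      posGateOf-val (OR _ _)  = cong₂ _∨_ pa≡ pb≡
      posGateOf-val (NOT _)   = trans (cong₂ _∧_ na≡ na≡) (∧-idem (not A))

      negGateOf-val : (gt : Gate W t) → gateVal pos neg f (negGateOf gt pa pb na nb) ≡ not (gateOp gt A B)
      negGateOf-val (AND _ _) = trans (cong₂ _∨_ na≡ nb≡) (sym (not-∧ A B))
      negGateOf-val (OR _ _)  = trans (cong₂ _∧_ na≡ nb≡) (sym (not-∨ A B))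
      negGateOf-val (NOT _)   = trans (cong₂ _∧_ pa≡ pa≡) (trans (∧-idem A) (sym (not-involutive A)))

  record RailCircuit {t} (src : SLP W t) (g : ℕ) : Set where
    constructor railCircuit
    field
      circuit     : SLP V g
      circuit-nnf : SLPNNF circuit
      rails       : Rails src circuit
  open RailCircuit public

  module RailStep {t g : ℕ} {src : SLP W t} (gt : Gate W t) (RC : RailCircuit src g) where
    a = fstArg gt
    b = sndArg gt
    c  = circuit RC
    R  = rails RC
    c₁ = c ▷ negGate a
    c₂ = c₁ ▷ negGate b
    e₂ : c ≼ c₂
    e₂ = ≼-▷ (negGate a) ⨾ ≼-▷ (negGate b)

    pa pb na nb : Wire V (2 + g)
    pa = lift e₂ (posWire R a)
    pb = lift e₂ (posWire R b)
    na = wk (negWire R a)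
    nb = negWire (Rails-≼ (≼-▷ (negGate a)) R) b

    c₃ = c₂ ▷ posGateOf gt pa pb na nb
    c₄ = c₃ ▷ negGateOf gt (wk pa) (wk pb) (wk na) (wk nb)
    e₄ : c ≼ c₄
    e₄ = e₂ ⨾ ≼-▷ (posGateOf gt pa pb na nb) ⨾ ≼-▷ (negGateOf gt (wk pa) (wk pb) (wk na) (wk nb))

    module _ {pos neg : V → Bool} (cons : Consistent pos neg) where
      A = srcWireVal src pos a
      B = srcWireVal src pos b

      pa-val : val c₂ pa pos neg ≡ A
      pa-val = trans (val-lift e₂ pos neg (posWire R a)) (posWire-val R cons a)
      pb-val : val c₂ pb pos neg ≡ B
      pb-val = trans (val-lift e₂ pos neg (posWire R b)) (posWire-val R cons b)
      na-val : val c₂ na pos neg ≡ not A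
      na-val = trans (val-lift (≼-▷ (negGate b)) pos neg (negWire R a)) (negWire-val R cons a)
      nb-val : val c₂ nb pos neg ≡ not B
      nb-val = negWire-val (Rails-≼ (≼-▷ (negGate a)) R) cons b

      wk-val : ∀ w {v : Bool} → val c₂ w pos neg ≡ v → val c₃ (wk w) pos neg ≡ v
      wk-val w = trans (val-lift (≼-▷ (posGateOf gt pa pb na nb)) pos neg w)

      top-pos-val : val c₄ (gate (suc zero)) pos neg ≡ srcVal (src ▷ gt) pos zero
      top-pos-val = trans (posGateOf-val {pa = pa} {pb} {na} {nb} pa-val pb-val na-val nb-val gt)
                          (sym (srcVal-▷ src gt pos))

      top-neg-val : val c₄ (gate zero) pos neg ≡ not (srcVal (src ▷ gt) pos zero)
      top-neg-val = trans (negGateOf-val {pa = wk pa} {wk pb} {wk na} {wk nb}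
                                         (wk-val pa pa-val) (wk-val pb pb-val) (wk-val na na-val) (wk-val nb nb-val) gt)
                          (cong not (sym (srcVal-▷ src gt pos)))

    result : RailCircuit (src ▷ gt) (4 + g)
    result = railCircuit c₄
      ((((circuit-nnf RC , negGate-nnf a) , negGate-nnf b) , posGateOf-nnf {pa = pa} {pb} {na} {nb} gt)
       , negGateOf-nnf {pa = wk pa} {wk pb} {wk na} {wk nb} gt)
      (record
        { posRail     = λ { zero → gate (suc zero) ; (suc j) → lift e₄ (posRail R j) }
        ; negRail     = λ { zero → gate zero       ; (suc j) → lift e₄ (negRail R j) }
        ; posRail-val = λ { cons zero → top-pos-val cons
                          ; cons (suc j) → trans (val-lift e₄ _ _ (posRail R j)) (posRail-val R cons j) }
        ; negRail-val = λ { cons zero → top-neg-val cons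
                          ; cons (suc j) → trans (val-lift e₄ _ _ (negRail R j)) (negRail-val R cons j) } })

  dualRail : ∀ {t} (src : SLP W t) → RailCircuit src (t * 4)
  dualRail []         = railCircuit [] tt (record { posRail = λ () ; negRail = λ ()
                                                  ; posRail-val = λ _ () ; negRail-val = λ _ () })
  dualRail (src ▷ gt) = RailStep.result gt (dualRail src)

-- From Skolem functions to SynNNF

module SynNNFFromSkolem {n m : ℕ} (F : Spec n m) (Ψ : Circuit (Fin m) n) where
  open DualRail {Fin m} {Fin n ⊎ Fin m} inj₂

  V = Fin n ⊎ Fin m

  ψ : (V → Bool) → Fin n → Bool
  ψ pos = eval Ψ (pos ∘ inj₂)

  record Stage : Set where
    constructor stage
    field
      gates : ℕ
      rc    : RailCircuit (prog Ψ) gates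
      acc   : Wire V gates
  open Stage

  accVal : Stage → (V → Bool) → (V → Bool) → Bool
  accVal s = val (circuit (rc s)) (acc s)

  module Gadget (l : Fin n) (s : Stage) where
    q  = out Ψ l
    c  = circuit (rc s)
    R  = rails (rc s)
    c₁ = c ▷ negGate q
    c₂ = c₁ ▷ NOT (inp (inj₁ l))
    c₃ = c₂ ▷ AND (inp (inj₁ l)) (wk (wk (posWire R q)))
    c₄ = c₃ ▷ AND (gate (suc zero)) (wk (wk (negWire R q)))
    c₅ = c₄ ▷ OR (gate (suc zero)) (gate zero)
    e₅ : c ≼ c₅
    e₅ = ≼-▷ _ ⨾ ≼-▷ _ ⨾ ≼-▷ _ ⨾ ≼-▷ _ ⨾ ≼-▷ _
    c₆ = c₅ ▷ AND (gate zero) (lift e₅ (acc s))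

    result : Stage
    result = stage (6 + gates s)
      (railCircuit c₆ (((((((circuit-nnf (rc s) , negGate-nnf q) , tt) , tt) , tt) , tt) , tt))
                   (Rails-≼ (e₅ ⨾ ≼-▷ _) R))
      (gate zero)

    result-val : ∀ {pos neg} → Consistent pos neg →
      accVal result pos neg ≡ iff⁺ (pos (inj₁ l)) (neg (inj₁ l)) (ψ pos l) ∧ accVal s pos neg
    result-val {pos} {neg} cons =
      cong₂ _∧_ (cong₂ _∨_ (cong (pos (inj₁ l) ∧_) ψ-val) (cong (neg (inj₁ l) ∧_) ¬ψ-val))
                (val-lift e₅ pos neg (acc s))
      where
      ψ-val : val c₂ (wk (wk (posWire R q))) pos neg ≡ ψ pos l
      ψ-val = trans (val-lift (≼-▷ _ ⨾ ≼-▷ _) pos neg (posWire R q)) (posWire-val R cons q)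
      ¬ψ-val : val c₃ (wk (wk (negWire R q))) pos neg ≡ not (ψ pos l)
      ¬ψ-val = trans (val-lift (≼-▷ _ ⨾ ≼-▷ _) pos neg (negWire R q)) (negWire-val R cons q)

  conjStep : Bool → Fin n → Stage → Stage
  conjStep true  l s = Gadget.result l s
  conjStep false l s = s

  conjStep-val : ∀ b l {s} {pos neg} → Consistent pos neg →
                 accVal (conjStep b l s) pos neg
                   ≡ (if b then iff⁺ (pos (inj₁ l)) (neg (inj₁ l)) (ψ pos l) else true) ∧ accVal s pos neg
  conjStep-val true  l {s} {pos} {neg} cons = Gadget.result-val l s {pos} {neg} cons
  conjStep-val false l cons = refl

  start : Stage
  start = stage (size Ψ * 4) (dualRail (prog Ψ)) (const true)

  final : Stage
  final = foldrFrom (λ l → conjStep (occurs F (toℕ l)) l) start 0 n refl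

  F̃ : Spec n m
  F̃ = record { size = gates final ; prog = circuit (rc final) ; out = λ _ → acc final }

  conjunct : Fin n → Bool → Bool → Bool → Bool
  conjunct l x x̄ p = if occurs F (toℕ l) then iff⁺ x x̄ p else true

  F̃-val : ∀ {pos neg} → Consistent pos neg →
          evalGen F̃ pos neg zero ≡ ⋀From (λ l → conjunct l (pos (inj₁ l)) (neg (inj₁ l)) (ψ pos l)) 0 n refl
  F̃-val {pos} {neg} cons = foldrFrom-sim (λ s b → accVal s pos neg ≡ b) refl
    (λ l acc≡b → trans (conjStep-val (occurs F (toℕ l)) l cons) (cong (_ ∧_) acc≡b)) 0 n refl

  F̃-size : size F̃ ≤ 6 * (1 + 2 * size F) + size Ψ * 4
  F̃-size = begin
    gates final
      ≡⟨ foldrFrom-measure gates 6 (occurs F) (λ l → conjStep-gates (occurs F (toℕ l)) l) 0 n refl ⟩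
    6 * count (occurs F) 0 n + size Ψ * 4  ≤⟨ +-monoˡ-≤ (size Ψ * 4) (*-monoʳ-≤ 6 (count-occurs F 0 n)) ⟩
    6 * (1 + 2 * size F) + size Ψ * 4      ∎
    where
    open ≤-Reasoning
    conjStep-gates : ∀ b l s → gates (conjStep b l s) ≡ 6 * indicator b + gates s
    conjStep-gates true  l s = refl
    conjStep-gates false l s = refl

  module _ (i : Fin n) (x : Fin n → Bool) (y : Fin m → Bool) where
    private
      r = toℕ i
      b = eval Ψ y i
      αx αx̄ : Bool → Fin n → Bool
      αx  j = cut true r (update r j x)
      αx̄ k = cut true r (update r k (not ∘ x))

    F̃-alpha : ∀ j k → alpha F̃ i j k x y ≡ ⋀From (λ l → conjunct l (αx j l) (αx̄ k l) (eval Ψ y l)) 0 n refl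
    F̃-alpha j k = F̃-val (λ _ → refl)

    -- x_i occurs in F̃ only in its own conjunct x_i ↔ ψ_i
    conjunct-choice : ∀ l → iff⁺ (αx true l) (αx̄ true l) (eval Ψ y l)
                            ≡ iff⁺ (αx b l) (αx̄ (not b) l) (eval Ψ y l)
    conjunct-choice l with toℕ l ≟ r
    ... | no l≢i = cong₂ (λ a ā → iff⁺ a ā (eval Ψ y l)) (if-cong-else (toℕ l <ᵇ r) (update-irrelevant x l≢i))
                                                          (if-cong-else (toℕ l <ᵇ r) (update-irrelevant (not ∘ x) l≢i))
    ... | yes l≡i with refl ← toℕ-injective l≡i = begin
      iff⁺ (αx true i) (αx̄ true i) b   ≡⟨ cong₂ (λ a ā → iff⁺ a ā b) (αx-at-i x) (αx-at-i (not ∘ x)) ⟩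
      b ∨ not b                        ≡⟨ ∨-inverseʳ b ⟩
      true                             ≡⟨ iff⁺-self b ⟨
      iff⁺ b (not b) b                 ≡⟨ cong₂ (λ a ā → iff⁺ a ā b) (αx-at-i x) (αx-at-i (not ∘ x)) ⟨
      iff⁺ (αx b i) (αx̄ (not b) i) b   ∎
      where
      open ≡-Reasoning
      αx-at-i : ∀ u {c} → cut true r (update r c u) i ≡ c
      αx-at-i u = cut-update-≡ u l≡i

    F̃-alpha-choice : alpha F̃ i true true x y ≡ alpha F̃ i b (not b) x y
    F̃-alpha-choice = begin
      alpha F̃ i true true x y  ≡⟨ F̃-alpha true true ⟩
      _                        ≡⟨ ⋀From-cong (λ l → if-cong-then (occurs F (toℕ l)) (conjunct-choice l)) 0 n refl ⟩
      _                        ≡⟨ F̃-alpha b (not b) ⟨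
      alpha F̃ i b (not b) x y  ∎
      where open ≡-Reasoning

  F̃-andUnrealizable : ∀ i → AndUnrealizable F̃ i
  F̃-andUnrealizable i x y (α¹¹ , α¹⁰ , α⁰¹) = excluded (eval Ψ y i) (trans (sym (F̃-alpha-choice i x y)) α¹¹)
    where
    excluded : ∀ b → alpha F̃ i b (not b) x y ≡ true → ⊥
    excluded true  h with () ← trans (sym h) α¹⁰
    excluded false h with () ← trans (sym h) α⁰¹

  F̃-synNNF : SynNNF F̃
  F̃-synNNF = circuit-nnf (rc final) , F̃-andUnrealizable

  F̃-⟦⟧ : ∀ x y → F̃ ⟦ x , y ⟧ ≡ ⋀From (λ l → conjunct l (x l) (not (x l)) (eval Ψ y l)) 0 n refl
  F̃-⟦⟧ x y = F̃-val (λ _ → refl)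

  F̃-at-Ψ : ∀ y → F̃ ⟦ eval Ψ y , y ⟧ ≡ true
  F̃-at-Ψ y = trans (F̃-⟦⟧ (eval Ψ y) y) (⋀From-true (λ l → conjunct-self l (eval Ψ y l)) 0 n refl)
    where
    conjunct-self : ∀ l p → conjunct l p (not p) p ≡ true
    conjunct-self l p with occurs F (toℕ l)
    ... | true  = iff⁺-self p
    ... | false = refl

  F̃-forces-Ψ : ∀ {x} y → F̃ ⟦ x , y ⟧ ≡ true → F ⟦ x , y ⟧ ≡ F ⟦ eval Ψ y , y ⟧
  F̃-forces-Ψ {x} y F̃x = evalGen-agree F λ
    { {inj₁ l} l∈F → x≡Ψ l l∈F , cong not (x≡Ψ l l∈F)
    ; {inj₂ _} _   → refl , refl }
    where
    x≡Ψ : ∀ l → inj₁ l ∈ vars F → x l ≡ eval Ψ y l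
    x≡Ψ l l∈F = iff⁺-sound (x l) (eval Ψ y l)
      (subst (λ c → (if c then _ else true) ≡ true) (occurs-∈ F l∈F)
             (⋀From-elim 0 n refl (trans (sym (F̃-⟦⟧ x y)) F̃x) l z≤n))

  F̃-⪯syn : IsSkolem F Ψ → F̃ ⪯syn F
  F̃-⪯syn skolem = (λ y _ → eval Ψ y , F̃-at-Ψ y)
                , (λ y x ∃x F̃x → trans (F̃-forces-Ψ y F̃x) (proj₁ (skolem y) ∃x))

module _ (c d s : ℕ) {t : ℕ} (t≤ : t ≤ c * (s + 1) ^ d) where
  private
    X = (s + 1) ^ d

    1≤X : 1 ≤ X
    1≤X = m^n>0 (s + 1) {{>-nonZero (m≤n+m 1 s)}} d

    X≤[s+1]X : X ≤ (s + 1) * X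
    X≤[s+1]X = ≤-trans (≤-reflexive (sym (*-identityˡ X))) (*-monoˡ-≤ X (m≤n+m 1 s))

    s+1≤[s+1]X : s + 1 ≤ (s + 1) * X
    s+1≤[s+1]X = ≤-trans (≤-reflexive (sym (*-identityʳ (s + 1)))) (*-monoʳ-≤ (s + 1) 1≤X)

  linear-size-bound : 6 * (1 + 2 * s) + t * 4 ≤ (4 * c + 12) * (s + 1) ^ suc d
  linear-size-bound = begin
    6 * (1 + 2 * s) + t * 4                  ≤⟨ +-mono-≤ (m≤m+n (6 * (1 + 2 * s)) 6) (*-monoˡ-≤ 4 t≤) ⟩
    (6 * (1 + 2 * s) + 6) + c * X * 4        ≡⟨ cong (_+ c * X * 4) (twelve s) ⟩
    12 * (s + 1) + c * X * 4
      ≤⟨ +-mono-≤ (*-monoʳ-≤ 12 s+1≤[s+1]X) (*-monoˡ-≤ 4 (*-monoʳ-≤ c X≤[s+1]X)) ⟩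
    12 * ((s + 1) * X) + c * ((s + 1) * X) * 4 ≡⟨ collect c ((s + 1) * X) ⟩
    (4 * c + 12) * ((s + 1) * X)             ∎
    where
    open ≤-Reasoning
    twelve : ∀ s → 6 * (1 + 2 * s) + 6 ≡ 12 * (s + 1)
    twelve = solve-∀
    collect : ∀ c Y → 12 * Y + c * Y * 4 ≡ (4 * c + 12) * Y
    collect = solve-∀

  quadratic-size-bound : t * (1 + 2 * t) ≤ c * (1 + 2 * c) * (s + 1) ^ (d + d)
  quadratic-size-bound = begin
    t * (1 + 2 * t)                 ≤⟨ *-mono-≤ t≤ (+-mono-≤ 1≤X (*-monoʳ-≤ 2 t≤)) ⟩
    c * X * (X + 2 * (c * X))       ≡⟨ square c X ⟩
    c * (1 + 2 * c) * (X * X)       ≡⟨ cong (c * (1 + 2 * c) *_) (^-distribˡ-+-* (s + 1) d d) ⟨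
    c * (1 + 2 * c) * (s + 1) ^ (d + d) ∎
    where
    open ≤-Reasoning
    square : ∀ c X → c * X * (X + 2 * (c * X)) ≡ c * (1 + 2 * c) * (X * X)
    square = solve-∀

IsSkolem-⪯syn : ∀ {n m} {F F̃ : Spec n m} {Ψ} → F̃ ⪯syn F → IsSkolem F̃ Ψ → IsSkolem F Ψ
IsSkolem-⪯syn (F̃-sat , F̃-sound) skolem y =
  (λ ∃x → F̃-sound y _ ∃x (proj₁ (skolem y) (F̃-sat y ∃x))) , (λ h → _ , h)

skolem⇒synNNF : (P : AnySpec → Set) → PolySkolem P → PolySynNNF P
skolem⇒synNNF P (c , d , poly) =
  4 * c + 12 , suc d , λ { (spec n m F) pS → construct F (poly (spec n m F) pS) }
  where
  construct : ∀ {n m} (F : Spec n m) →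
              Σ (Circuit (Fin m) n) (λ Ψ → IsSkolem F Ψ × size Ψ ≤ c * (size F + 1) ^ d) →
              Σ (Spec n m) λ F̃ → SynNNF F̃ × (F̃ ⪯syn F) × size F̃ ≤ (4 * c + 12) * (size F + 1) ^ suc d
  construct F (Ψ , skolem , Ψ-size) =
    F̃ , F̃-synNNF , F̃-⪯syn skolem , ≤-trans F̃-size (linear-size-bound c d (size F) Ψ-size)
    where open SynNNFFromSkolem F Ψ

synNNF⇒skolem : (P : AnySpec → Set) → PolySynNNF P → PolySkolem P
synNNF⇒skolem P (c , d , poly) =
  c * (1 + 2 * c) , d + d , λ { (spec n m F) pS → construct F (poly (spec n m F) pS) }
  where
  construct : ∀ {n m} (F : Spec n m) →
              Σ (Spec n m) (λ F̃ → SynNNF F̃ × (F̃ ⪯syn F) × size F̃ ≤ c * (size F + 1) ^ d) →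
              Σ (Circuit (Fin m) n) λ Ψ → IsSkolem F Ψ × size Ψ ≤ c * (1 + 2 * c) * (size F + 1) ^ (d + d)
  construct F (F̃ , synNNF , F̃⪯F , F̃-size) =
    skolemCircuit , IsSkolem-⪯syn {F = F} {F̃} {skolemCircuit} F̃⪯F (skolemCircuit-isSkolem synNNF)
                  , ≤-trans skolemCircuit-size (quadratic-size-bound c d (size F) F̃-size)
    where open SkolemFromSynNNF F̃

theorem8 : (P : AnySpec → Set) → PolySkolem P ⇔ PolySynNNF P
theorem8 P = mk⇔ (skolem⇒synNNF P) (synNNF⇒skolem P)
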